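{- Let $C : \mathsf{Form} \to \mathsf{Prop}$ be any predicate such that for all formulas $A,B$, $C(A \to B)$ and $C(A)$ imply $C(B)$, and such that $C(\bot)$ does not hold. Suppose there is a formula $B$ with $B \simeq_C \neg B$, and suppose there exists a function $d : \mathsf{Form} \to \{\mathsf{tt},\mathsf{ff}\}$ such that for every formula $A$, $d(A) = \mathsf{tt}$ implies $C(A)$ and $d(A) = \mathsf{ff}$ implies $C(\neg A)$. Then a contradiction follows.
   Context: $\mathsf{Form}$ is the type of closed formulas generated by $A,B ::= \bot \mid A \to B$; $\neg A$ abbreviates $A \to \bot$. For a predicate $C$ on $\mathsf{Form}$, $A \simeq_C B$ means $C(A \to B) \land C(B \to A)$. -}

module Defs where

open import Data.Product using (_×_)

data Form : Set where
  ⊥' : Form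
  _⇒_ : Form → Form → Form

infixr 5 _⇒_

¬' : Form → Form
¬' A = A ⇒ ⊥'

_≃[_]_ : Form → (Form → Set) → Form → Set
A ≃[ C ] B = C (A ⇒ B) × C (B ⇒ A)

{-# OPTIONS --safe #-}
module Submission where

open import Defs
open import Data.Bool using (Bool; true; false)
open import Data.Empty using (⊥)
open import Data.Product using (proj₁; proj₂)
open import Relation.Binary.PropositionalEquality using (_≡_)
open import Relation.Nullary using (¬_)

-- Whichever way d decides the liar formula B, C proves both B and ¬ B, hence ⊥.

ClosedUnderMP : (Form → Set) → Set
ClosedUnderMP C = ∀ A B → C (A ⇒ B) → C A → C B

module _ {C : Form → Set} (mp : ClosedUnderMP C) where

  contradiction⇒⊥' : ∀ A → C A → C (¬' A) → C ⊥'
  contradiction⇒⊥' A cA c¬A = mp A ⊥' c¬A cA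

  module _ {B : Form} (B≃¬B : B ≃[ C ] ¬' B) where

    liar-proved⇒⊥' : C B → C ⊥'
    liar-proved⇒⊥' cB = contradiction⇒⊥' B cB (mp B (¬' B) (proj₁ B≃¬B) cB)

    liar-refuted⇒⊥' : C (¬' B) → C ⊥'
    liar-refuted⇒⊥' c¬B = contradiction⇒⊥' B (mp (¬' B) B (proj₂ B≃¬B) c¬B) c¬B

theorem3p13 : (C : Form → Set) →
    (∀ A B → C (A ⇒ B) → C A → C B) →
    ¬ C ⊥' →
    (B : Form) → B ≃[ C ] ¬' B →
    (d : Form → Bool) →
    (∀ A → d A ≡ true → C A) →
    (∀ A → d A ≡ false → C (¬' A)) →
    ⊥
theorem3p13 C mp ¬C⊥ B B≃¬B d d-true d-false with d B in dB≡
... | true  = ¬C⊥ (liar-proved⇒⊥' mp B≃¬B (d-true B dB≡))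
... | false = ¬C⊥ (liar-refuted⇒⊥' mp B≃¬B (d-false B dB≡))
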